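{- Let $\mathscr G_{\mathbf{WSO}}$ be the set of all finite node-labeled digraphs that are weakly connected, simple and oriented. Define $d_e:\mathscr G_{\mathbf{WSO}}\times\mathscr G_{\mathbf{WSO}}\to[0,1]$ by $$d_e(G,G')=1-\frac{\operatorname{DMCES}(G,G')}{\max(|\mathcal D|,|\mathcal D'|)},$$ where $\mathcal D,\mathcal D'$ are the edge sets of $G,G'$. Then $d_e$ is a metric on $\mathscr G_{\mathbf{WSO}}$.
   Context: A node-labeled digraph $G=(V,\mathcal D,\ell_v)$ consists of a finite node set $V$, directed edges $\mathcal D\subseteq V\times V$, and a node-labeling function $\ell_v$ on $V$. Weakly connected: the underlying undirected graph is connected. Simple: no self-loops and no parallel edges with the same source and target. Oriented: no pair $(u,v),(v,u)$ both in $\mathcal D$. Graphs are considered up to isomorphism, where an isomorphism of node-labeled digraphs is a label-preserving bijection $\gamma:V\to V'$ with $(u,v)\in\mathcal D$ iff $(\gamma(u),\gamma(v))\in\mathcal D'$. For node-labeled digraphs $G=(V,\mathcal D,\ell_v)$, $G'=(V',\mathcal D',\ell'_v)$: a feasible solution is a pair $(U,\phi)$ with $U\subseteq V$ and $\phi:U\to V'$ injective with $\ell'_v(\phi(u))=\ell_v(u)$ for all $u\in U$; its score is $\mathcal P(U,\phi)=|\{(v_1,v_2)\in U\times U:(v_1,v_2)\in\mathcal D\text{ and }(\phi(v_1),\phi(v_2))\in\mathcal D'\}|$; and $\operatorname{DMCES}(G,G')$ is the maximum score over all feasible solutions. -}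

module Defs where

open import Data.Nat using (ℕ; zero; suc; _+_; _≤_; _<_; _⊔_; >-nonZero)
open import Data.Nat.Properties using (≤-trans; m≤m⊔n)
open import Data.Integer using (+_)
open import Data.Rational using (ℚ; _-_; 1ℚ; _/_)
open import Data.Bool using (Bool; true; false; _∧_; if_then_else_)
open import Data.Fin using (Fin)
open import Data.List using (List; map; allFin)
open import Data.Nat.ListAction using (sum)
open import Data.Product using (Σ; _×_)
open import Relation.Binary.PropositionalEquality using (_≡_)
open import Function.Bundles using (Inverse)
open import Relation.Binary.PropositionalEquality using (setoid)
open import Function.Bundles using (_↔_)

-- Parallel edges with the same
-- source and target cannot be represented, so that part of simplicity is built in.
record Digraph (L : Set) : Set where
  field
    n     : ℕ
    label : Fin n → L
    edge  : Fin n → Fin n → Bool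
open Digraph public

countPairs : (n : ℕ) → (Fin n → Fin n → Bool) → ℕ
countPairs n p = sum (map (λ i → sum (map (λ j → if p i j then 1 else 0) (allFin n))) (allFin n))

edgeCount : {L : Set} → Digraph L → ℕ
edgeCount G = countPairs (n G) (edge G)

data Reach {L : Set} (G : Digraph L) : Fin (n G) → Fin (n G) → Set where
  here : ∀ {i} → Reach G i i
  fwd  : ∀ {i j k} → edge G i j ≡ true → Reach G j k → Reach G i k
  bwd  : ∀ {i j k} → edge G j i ≡ true → Reach G j k → Reach G i k

WeaklyConnected : {L : Set} → Digraph L → Set
WeaklyConnected G = ∀ i j → Reach G i j

-- no self-loops (parallel edges are excluded by the representation)
Simple : {L : Set} → Digraph L → Set
Simple G = ∀ i → edge G i i ≡ false

Oriented : {L : Set} → Digraph L → Set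
Oriented G = ∀ i j → edge G i j ≡ true → edge G j i ≡ false

-- members of 𝒢_WSO on which d_e is defined (at least one edge)
record WSO (L : Set) : Set where
  field
    graph     : Digraph L
    weakly    : WeaklyConnected graph
    simple    : Simple graph
    oriented  : Oriented graph
    hasEdge   : 1 ≤ edgeCount graph
open WSO public

record Iso {L : Set} (G G' : Digraph L) : Set where
  field
    γ        : Fin (n G) ↔ Fin (n G')
    labelPres : ∀ i → label G' (Inverse.to γ i) ≡ label G i
    edgePres  : ∀ i j → edge G' (Inverse.to γ i) (Inverse.to γ j) ≡ edge G i j

-- feasible solution (U , φ): U ⊆ V given by its indicator, φ : U → V'
-- given as a function on V whose values outside U are irrelevant;
-- φ is injective on U and label-preserving on U.
record Feasible {L : Set} (G G' : Digraph L) : Set where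
  field
    U    : Fin (n G) → Bool
    φ    : Fin (n G) → Fin (n G')
    inj  : ∀ i j → U i ≡ true → U j ≡ true → φ i ≡ φ j → i ≡ j
    lab  : ∀ i → U i ≡ true → label G' (φ i) ≡ label G i

score : {L : Set} {G G' : Digraph L} → Feasible G G' → ℕ
score {G = G} {G'} s = countPairs (n G) (λ i j →
  U i ∧ U j ∧ edge G i j ∧ edge G' (φ i) (φ j))
  where open Feasible s

IsDMCES : {L : Set} → Digraph L → Digraph L → ℕ → Set
IsDMCES G G' k = Σ (Feasible G G') (λ s → score s ≡ k) × (∀ (s : Feasible G G') → score s ≤ k)

dₑ : {L : Set} → (WSO L → WSO L → ℕ) → WSO L → WSO L → ℚ
dₑ dm G G' = 1ℚ - ((+ dm G G') / (edgeCount (graph G) ⊔ edgeCount (graph G'))) {{>-nonZero pos}}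
  where
  pos : 0 < edgeCount (graph G) ⊔ edgeCount (graph G')
  pos = ≤-trans (hasEdge G) (m≤m⊔n (edgeCount (graph G)) (edgeCount (graph G')))

-- A solution (U, φ) from G to G'
-- reverses, via φ⁻¹ on φ(U), to a solution from G' to G of at least the same score, so DMCES
-- is symmetric.  Solutions G → G' and G' → G'' compose, and inclusion–exclusion over the pairs
-- of G' gives DMCES(G,G') + DMCES(G',G'') ≤ DMCES(G,G'') + |𝒟'|: pairs preserved both by the
-- reverse of the first solution and by the second pull back injectively to pairs preserved by
-- the composite, and pairs preserved by either are edges of G'.  Clearing denominators, this
-- gives the triangle inequality after a case split on the largest of the three edge counts.
-- Finally d_e = 0 yields a solution preserving every edge of G and, through its reverse, every
-- edge of G'; a weakly connected graph with an edge has no isolated node, so U is all of V and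
-- φ is a bijection preserving and reflecting edges.

module Submission where

open import Defs
open import Data.Nat using (ℕ)

module Counting where

  open import Data.Nat using (ℕ; _+_; _≤_; _<_; z≤n; s≤s)
  open import Data.Nat.Properties
    using (≤-refl; ≤-trans; ≤-reflexive; +-mono-≤; +-mono-≤-<; +-comm; module ≤-Reasoning)
  open import Data.Nat.ListAction using (sum)
  open import Data.Nat.ListAction.Properties using (sum-++)
  open import Data.Nat.Solver using (module +-*-Solver)
  open import Data.Bool using (Bool; true; false; _∧_; _∨_; not; if_then_else_)
  open import Data.Bool.Properties using (∧-identityʳ; not-¬)
  open import Data.Fin using (Fin)
  import Data.Fin.Properties as Fin
  open import Data.List using (List; []; _∷_; _++_; map; allFin; cartesianProduct)
  open import Data.List.Properties using (map-++; map-∘)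
  open import Data.List.Membership.Propositional using (_∈_; _∉_)
  open import Data.List.Membership.Propositional.Properties using (∈-allFin; ∈-cartesianProduct⁺)
  open import Data.List.Relation.Unary.Any using (here; there)
  open import Data.List.Relation.Unary.Unique.Propositional using (Unique; _∷_)
  open import Data.List.Relation.Unary.Unique.Propositional.Properties
    using (allFin⁺; cartesianProduct⁺; Unique[x∷xs]⇒x∉xs)
  open import Data.Product using (Σ; _×_; _,_; proj₁; proj₂; uncurry)
  open import Data.Product.Properties using (≡-dec)
  open import Function using (_∘_)
  open import Relation.Binary.Definitions using (DecidableEquality)
  open import Relation.Binary.PropositionalEquality
    using (_≡_; _≢_; refl; sym; cong; cong₂; module ≡-Reasoning)
  open import Relation.Nullary using (does; yes; no; contradiction)

  indicator : Bool → ℕ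
  indicator b = if b then 1 else 0

  count : {A : Set} → (A → Bool) → List A → ℕ
  count c xs = sum (map (indicator ∘ c) xs)

  _⊆ᵇ_ : {A : Set} → (A → Bool) → (A → Bool) → Set
  c ⊆ᵇ d = ∀ a → c a ≡ true → d a ≡ true

  ∧-true⁻ : {a b : Bool} → a ∧ b ≡ true → a ≡ true × b ≡ true
  ∧-true⁻ {true} b≡true = refl , b≡true

  ∧-true⁺ : {a b : Bool} → a ≡ true → b ≡ true → a ∧ b ≡ true
  ∧-true⁺ refl b≡true = b≡true

  indicator-mono : {a b : Bool} → (a ≡ true → b ≡ true) → indicator a ≤ indicator b
  indicator-mono {false} _  = z≤n
  indicator-mono {true}  a⇒b rewrite a⇒b refl = ≤-refl

  module _ {A : Set} where

    count-++ : (c : A → Bool) (xs ys : List A) → count c (xs ++ ys) ≡ count c xs + count c ys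
    count-++ c xs ys = begin
      sum (map (indicator ∘ c) (xs ++ ys))                    ≡⟨ cong sum (map-++ (indicator ∘ c) xs ys) ⟩
      sum (map (indicator ∘ c) xs ++ map (indicator ∘ c) ys)  ≡⟨ sum-++ (map (indicator ∘ c) xs) _ ⟩
      count c xs + count c ys                                 ∎
      where open ≡-Reasoning

    count-map : {B : Set} (c : B → Bool) (f : A → B) (xs : List A) → count c (map f xs) ≡ count (c ∘ f) xs
    count-map c f xs = cong sum (sym (map-∘ xs))

    count-mono : {c d : A → Bool} → c ⊆ᵇ d → (xs : List A) → count c xs ≤ count d xs
    count-mono c⊆d []       = z≤n
    count-mono c⊆d (x ∷ xs) = +-mono-≤ (indicator-mono (c⊆d x)) (count-mono c⊆d xs)

    count-∧+count-∨ : (c d : A → Bool) (xs : List A) →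
                      count (λ a → c a ∧ d a) xs + count (λ a → c a ∨ d a) xs ≡ count c xs + count d xs
    count-∧+count-∨ c d []       = refl
    count-∧+count-∨ c d (x ∷ xs) = begin
      (∧x + ∧xs) + (∨x + ∨xs)   ≡⟨ interchange ∧x ∧xs ∨x ∨xs ⟩
      (∧x + ∨x) + (∧xs + ∨xs)   ≡⟨ cong₂ _+_ (pointwise (c x) (d x)) (count-∧+count-∨ c d xs) ⟩
      (cx + dx) + (cxs + dxs)   ≡⟨ interchange cx dx cxs dxs ⟩
      (cx + cxs) + (dx + dxs)   ∎
      where
      open ≡-Reasoning
      ∧x = indicator (c x ∧ d x)
      ∨x = indicator (c x ∨ d x)
      ∧xs = count (λ a → c a ∧ d a) xs
      ∨xs = count (λ a → c a ∨ d a) xs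
      cx = indicator (c x)
      dx = indicator (d x)
      cxs = count c xs
      dxs = count d xs
      interchange : (a b c d : ℕ) → (a + b) + (c + d) ≡ (a + c) + (b + d)
      interchange = solve 4 (λ a b c d → (a :+ b) :+ (c :+ d) := (a :+ c) :+ (b :+ d)) refl
        where open +-*-Solver
      pointwise : (a b : Bool) → indicator (a ∧ b) + indicator (a ∨ b) ≡ indicator a + indicator b
      pointwise false b = refl
      pointwise true  b = +-comm (indicator b) 1

    count-witness : (c : A → Bool) (xs : List A) → 1 ≤ count c xs → Σ A (λ a → c a ≡ true)
    count-witness c []       ()
    count-witness c (x ∷ xs) pos with c x in cx
    ... | true  = x , cx
    ... | false = count-witness c xs pos

  module _ {A : Set} (_≟_ : DecidableEquality A) where

    without : A → (A → Bool) → A → Bool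
    without z c a = c a ∧ not (does (a ≟ z))

    without⁻ : {z : A} (c : A → Bool) (a : A) → without z c a ≡ true → c a ≡ true × a ≢ z
    without⁻ {z} c a h with c a | a ≟ z
    ... | true | no a≢z = refl , a≢z

    without⁺ : {z : A} (c : A → Bool) (a : A) → c a ≡ true → a ≢ z → without z c a ≡ true
    without⁺ {z} c a ca a≢z with a ≟ z
    ... | yes a≡z = contradiction a≡z a≢z
    ... | no _    = ∧-true⁺ ca refl

    count-without-∉ : (c : A → Bool) {z : A} (xs : List A) → z ∉ xs →
                      count (without z c) xs ≡ count c xs
    count-without-∉ c     []       _   = refl
    count-without-∉ c {z} (x ∷ xs) z∉ with x ≟ z
    ... | yes refl = contradiction (here refl) z∉
    ... | no _     =
      cong₂ _+_ (cong indicator (∧-identityʳ (c x))) (count-without-∉ c xs (z∉ ∘ there))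

    count-without-< : (c : A → Bool) {z : A} {xs : List A} → z ∈ xs → c z ≡ true →
                      count (without z c) xs < count c xs
    count-without-< c {z} {_ ∷ xs} (here refl) cz with z ≟ z
    ... | no z≢z = contradiction refl z≢z
    ... | yes _ rewrite cz = s≤s (count-mono (λ a → proj₁ ∘ ∧-true⁻) xs)
    count-without-< c {z} {x ∷ _} (there z∈xs) cz =
      +-mono-≤-< (indicator-mono {without z c x} (proj₁ ∘ ∧-true⁻)) (count-without-< c z∈xs cz)

  count-injection : {A B : Set} (_≟ᴬ_ : DecidableEquality A) (_≟ᴮ_ : DecidableEquality B)
    {c : A → Bool} {d : B → Bool} (f : A → B) {xs : List A} {ys : List B} →
    Unique xs →
    (∀ a → c a ≡ true → d (f a) ≡ true) →
    (∀ a a′ → c a ≡ true → c a′ ≡ true → f a ≡ f a′ → a ≡ a′) →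
    (∀ b → d b ≡ true → b ∈ ys) →
    count c xs ≤ count d ys
  count-injection _≟ᴬ_ _≟ᴮ_ f {[]} _ _ _ _ = z≤n
  count-injection _≟ᴬ_ _≟ᴮ_ {c} {d} f {x ∷ xs} {ys} unique@(_ ∷ unique-xs) maps inj complete
    with c x in cx
  ... | false = count-injection _≟ᴬ_ _≟ᴮ_ f unique-xs maps inj complete
  ... | true  = begin-strict
    count c xs                        ≡⟨ count-without-∉ _≟ᴬ_ c xs (Unique[x∷xs]⇒x∉xs unique) ⟨
    count (without _≟ᴬ_ x c) xs       ≤⟨ count-injection _≟ᴬ_ _≟ᴮ_ f unique-xs maps′ inj′ complete′ ⟩
    count (without _≟ᴮ_ (f x) d) ys   <⟨ count-without-< _≟ᴮ_ d (complete (f x) dfx) dfx ⟩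
    count d ys                        ∎
    where
    open ≤-Reasoning
    dfx = maps x cx
    maps′ : ∀ a → without _≟ᴬ_ x c a ≡ true → without _≟ᴮ_ (f x) d (f a) ≡ true
    maps′ a h = let ca , a≢x = without⁻ _≟ᴬ_ c a h in
      without⁺ _≟ᴮ_ d (f a) (maps a ca) (a≢x ∘ inj a x ca cx)
    inj′ : ∀ a a′ → without _≟ᴬ_ x c a ≡ true → without _≟ᴬ_ x c a′ ≡ true → f a ≡ f a′ → a ≡ a′
    inj′ a a′ h h′ = inj a a′ (proj₁ (without⁻ _≟ᴬ_ c a h)) (proj₁ (without⁻ _≟ᴬ_ c a′ h′))
    complete′ : ∀ b → without _≟ᴮ_ (f x) d b ≡ true → b ∈ ys
    complete′ b h = complete b (proj₁ (without⁻ _≟ᴮ_ d b h))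

  pairs : (n : ℕ) → List (Fin n × Fin n)
  pairs n = cartesianProduct (allFin n) (allFin n)

  ∈-pairs : {n : ℕ} (ij : Fin n × Fin n) → ij ∈ pairs n
  ∈-pairs (i , j) = ∈-cartesianProduct⁺ (∈-allFin i) (∈-allFin j)

  countPairs≡count : (n : ℕ) (p : Fin n → Fin n → Bool) → countPairs n p ≡ count (uncurry p) (pairs n)
  countPairs≡count n p = rows (allFin n)
    where
    open ≡-Reasoning
    rows : (is : List (Fin n)) →
           sum (map (λ i → count (p i) (allFin n)) is) ≡ count (uncurry p) (cartesianProduct is (allFin n))
    rows []       = refl
    rows (i ∷ is) = begin
      count (p i) (allFin n) + sum (map (λ i → count (p i) (allFin n)) is)
        ≡⟨ cong₂ _+_ (count-map (uncurry p) (i ,_) (allFin n)) (sym (rows is)) ⟨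
      count (uncurry p) (map (i ,_) (allFin n)) + count (uncurry p) (cartesianProduct is (allFin n))
        ≡⟨ count-++ (uncurry p) (map (i ,_) (allFin n)) _ ⟨
      count (uncurry p) (cartesianProduct (i ∷ is) (allFin n))
        ∎

  module _ {n : ℕ} where

    _≟ᵖ_ : DecidableEquality (Fin n × Fin n)
    _≟ᵖ_ = ≡-dec Fin._≟_ Fin._≟_

    _⊆ᵖ_ : (p q : Fin n → Fin n → Bool) → Set
    p ⊆ᵖ q = ∀ i j → p i j ≡ true → q i j ≡ true

    countPairs-mono : (p q : Fin n → Fin n → Bool) → p ⊆ᵖ q → countPairs n p ≤ countPairs n q
    countPairs-mono p q p⊆q = begin
      countPairs n p               ≡⟨ countPairs≡count n p ⟩
      count (uncurry p) (pairs n)  ≤⟨ count-mono (uncurry p⊆q) (pairs n) ⟩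
      count (uncurry q) (pairs n)  ≡⟨ countPairs≡count n q ⟨
      countPairs n q               ∎
      where open ≤-Reasoning

    countPairs-< : (p q : Fin n → Fin n → Bool) → p ⊆ᵖ q →
                   ∀ i j → q i j ≡ true → p i j ≡ false → countPairs n p < countPairs n q
    countPairs-< p q p⊆q i j qij pij = begin-strict
      countPairs n p                                      ≡⟨ countPairs≡count n p ⟩
      count (uncurry p) (pairs n)                         ≤⟨ count-mono p⊆q-ij (pairs n) ⟩
      count (without _≟ᵖ_ (i , j) (uncurry q)) (pairs n)  <⟨ count-without-< _≟ᵖ_ (uncurry q) (∈-pairs (i , j)) qij ⟩
      count (uncurry q) (pairs n)                         ≡⟨ countPairs≡count n q ⟨
      countPairs n q                                      ∎
      where
      open ≤-Reasoning
      p⊆q-ij : uncurry p ⊆ᵇ without _≟ᵖ_ (i , j) (uncurry q)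
      p⊆q-ij (k , l) pkl =
        without⁺ _≟ᵖ_ (uncurry q) (k , l) (p⊆q k l pkl) λ { refl → not-¬ pkl pij }

    countPairs-∧+∨ : (p q : Fin n → Fin n → Bool) →
                     countPairs n (λ i j → p i j ∧ q i j) + countPairs n (λ i j → p i j ∨ q i j)
                       ≡ countPairs n p + countPairs n q
    countPairs-∧+∨ p q = begin
      countPairs n (λ i j → p i j ∧ q i j) + countPairs n (λ i j → p i j ∨ q i j)
        ≡⟨ cong₂ _+_ (countPairs≡count n _) (countPairs≡count n _) ⟩
      count (λ a → uncurry p a ∧ uncurry q a) (pairs n) + count (λ a → uncurry p a ∨ uncurry q a) (pairs n)
        ≡⟨ count-∧+count-∨ (uncurry p) (uncurry q) (pairs n) ⟩
      count (uncurry p) (pairs n) + count (uncurry q) (pairs n)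
        ≡⟨ cong₂ _+_ (countPairs≡count n p) (countPairs≡count n q) ⟨
      countPairs n p + countPairs n q
        ∎
      where open ≡-Reasoning

    countPairs-witness : (p : Fin n → Fin n → Bool) → 1 ≤ countPairs n p →
                         Σ (Fin n × Fin n) (λ (i , j) → p i j ≡ true)
    countPairs-witness p pos =
      count-witness (uncurry p) (pairs n) (≤-trans pos (≤-reflexive (countPairs≡count n p)))

  countPairs-injection : {n m : ℕ} (f : Fin n → Fin m) (S : Fin n → Bool)
    (p : Fin n → Fin n → Bool) (q : Fin m → Fin m → Bool) →
    (∀ i j → p i j ≡ true → (S i ≡ true × S j ≡ true) × q (f i) (f j) ≡ true) →
    (∀ i i′ → S i ≡ true → S i′ ≡ true → f i ≡ f i′ → i ≡ i′) →
    countPairs n p ≤ countPairs m q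
  countPairs-injection {n} {m} f S p q maps inj = begin
    countPairs n p               ≡⟨ countPairs≡count n p ⟩
    count (uncurry p) (pairs n)  ≤⟨ count-injection _≟ᵖ_ _≟ᵖ_ f² (cartesianProduct⁺ (allFin⁺ n) (allFin⁺ n))
                                      (λ (i , j) pij → proj₂ (maps i j pij)) inj² (λ b _ → ∈-pairs b) ⟩
    count (uncurry q) (pairs m)  ≡⟨ countPairs≡count m q ⟨
    countPairs m q               ∎
    where
    open ≤-Reasoning
    f² : Fin n × Fin n → Fin m × Fin m
    f² (i , j) = f i , f j
    inj² : ∀ a a′ → uncurry p a ≡ true → uncurry p a′ ≡ true → f² a ≡ f² a′ → a ≡ a′
    inj² (i , j) (i′ , j′) pij pij′ eq =
      let (Si , Sj) , _ = maps i j pij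
          (Si′ , Sj′) , _ = maps i′ j′ pij′
      in cong₂ _,_ (inj i i′ Si Si′ (cong proj₁ eq)) (inj j j′ Sj Sj′ (cong proj₂ eq))

module Solutions where

  open import Data.Nat using (ℕ; _+_; _≤_)
  open import Data.Nat.Properties using (≤-trans; +-mono-≤; +-monoˡ-≤; <⇒≱; module ≤-Reasoning)
  open import Data.Bool using (Bool; true; false; _∧_; _∨_)
  import Data.Bool.Properties as Bool
  open import Data.Fin using (Fin)
  import Data.Fin.Properties as Fin
  open import Data.Product using (Σ; _×_; _,_; proj₁; proj₂)
  open import Data.Sum using (_⊎_; inj₁; inj₂)
  open import Function using (_∘_)
  open import Function.Bundles using (Inverse; Injection; mk⇔; mk↔ₛ′)
  open import Function.Properties.Inverse using (↔-sym; ↔⇒↣)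
  open import Relation.Binary.PropositionalEquality using (_≡_; refl; sym; trans; cong; cong₂; subst₂)
  open import Relation.Nullary using (Dec; does; yes; no; contradiction)
  open import Relation.Nullary.Decidable using (_×-dec_)
  open Counting

  module _ {L : Set} {G G' : Digraph L} (s : Feasible G G') where
    open Feasible s

    -- score s is definitionally countPairs (n G) preserved.
    preserved : Fin (n G) → Fin (n G) → Bool
    preserved i j = U i ∧ U j ∧ edge G i j ∧ edge G' (φ i) (φ j)

    record Preserved (i j : Fin (n G)) : Set where
      field
        in-U-src  : U i ≡ true
        in-U-tgt  : U j ≡ true
        edge-dom  : edge G i j ≡ true
        edge-cod  : edge G' (φ i) (φ j) ≡ true

    preserved⁻ : ∀ {i j} → preserved i j ≡ true → Preserved i j
    preserved⁻ h =
      let Ui , h₁ = ∧-true⁻ h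
          Uj , h₂ = ∧-true⁻ h₁
          e  , e′ = ∧-true⁻ h₂
      in record { in-U-src = Ui ; in-U-tgt = Uj ; edge-dom = e ; edge-cod = e′ }

    preserved⁺ : ∀ {i j} → Preserved i j → preserved i j ≡ true
    preserved⁺ record { in-U-src = Ui ; in-U-tgt = Uj ; edge-dom = e ; edge-cod = e′ } =
      ∧-true⁺ Ui (∧-true⁺ Uj (∧-true⁺ e e′))

    preserved⊆edge : preserved ⊆ᵖ edge G
    preserved⊆edge i j = Preserved.edge-dom ∘ preserved⁻

    score≤edgeCount-dom : score s ≤ edgeCount G
    score≤edgeCount-dom = countPairs-mono preserved (edge G) preserved⊆edge

    score≤edgeCount-cod : score s ≤ edgeCount G'
    score≤edgeCount-cod = countPairs-injection φ U preserved (edge G')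
      (λ i j h → let open Preserved (preserved⁻ h) in (in-U-src , in-U-tgt) , edge-cod) inj

    edgeCount≤score⇒preserved : edgeCount G ≤ score s → ∀ i j → edge G i j ≡ true → preserved i j ≡ true
    edgeCount≤score⇒preserved full i j eij with preserved i j in pij
    ... | true  = refl
    ... | false = contradiction full (<⇒≱ (countPairs-< preserved (edge G) preserved⊆edge i j eij pij))

  -- Off φ(U), φ⁻¹ returns the junk node default.
  module _ {L : Set} {G G' : Digraph L} (s : Feasible G G') (default : Fin (n G)) where
    open Feasible s

    Preimage : Fin (n G') → Set
    Preimage j = Σ (Fin (n G)) (λ i → U i ≡ true × φ i ≡ j)

    preimage? : (j : Fin (n G')) → Dec (Preimage j)
    preimage? j = Fin.any? (λ i → (U i Bool.≟ true) ×-dec (φ i Fin.≟ j))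

    U⁻¹ : Fin (n G') → Bool
    U⁻¹ j = does (preimage? j)

    φ⁻¹ : Fin (n G') → Fin (n G)
    φ⁻¹ j with preimage? j
    ... | yes (i , _) = i
    ... | no _        = default

    φ∘φ⁻¹ : ∀ j → U⁻¹ j ≡ true → U (φ⁻¹ j) ≡ true × φ (φ⁻¹ j) ≡ j
    φ∘φ⁻¹ j _ with preimage? j
    ... | yes (_ , Ui , φi≡j) = Ui , φi≡j

    φ⁻¹∘φ : ∀ i → U i ≡ true → U⁻¹ (φ i) ≡ true × φ⁻¹ (φ i) ≡ i
    φ⁻¹∘φ i Ui with preimage? (φ i)
    ... | yes (i′ , Ui′ , φi′≡φi) = refl , inj i′ i Ui′ Ui φi′≡φi
    ... | no ∄                    = contradiction (i , Ui , refl) ∄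

    φ⁻¹-injective : ∀ j j′ → U⁻¹ j ≡ true → U⁻¹ j′ ≡ true → φ⁻¹ j ≡ φ⁻¹ j′ → j ≡ j′
    φ⁻¹-injective j j′ Uj Uj′ eq =
      trans (sym (proj₂ (φ∘φ⁻¹ j Uj))) (trans (cong φ eq) (proj₂ (φ∘φ⁻¹ j′ Uj′)))

    reverse : Feasible G' G
    reverse = record
      { U   = U⁻¹
      ; φ   = φ⁻¹
      ; inj = φ⁻¹-injective
      ; lab = λ j Uj → let Ui , φi≡j = φ∘φ⁻¹ j Uj in
                       trans (sym (lab (φ⁻¹ j) Ui)) (cong (label G') φi≡j)
      }

    preserved⇒reverse-preserved : ∀ {i j} → preserved s i j ≡ true → preserved reverse (φ i) (φ j) ≡ true
    preserved⇒reverse-preserved {i} {j} h = preserved⁺ reverse record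
      { in-U-src = proj₁ (φ⁻¹∘φ i in-U-src)
      ; in-U-tgt = proj₁ (φ⁻¹∘φ j in-U-tgt)
      ; edge-dom = edge-cod
      ; edge-cod = subst₂ (λ a b → edge G a b ≡ true)
                   (sym (proj₂ (φ⁻¹∘φ i in-U-src))) (sym (proj₂ (φ⁻¹∘φ j in-U-tgt))) edge-dom
      }
      where open Preserved (preserved⁻ s h)

    reverse-preserved⇒preserved : ∀ {k l} → preserved reverse k l ≡ true → preserved s (φ⁻¹ k) (φ⁻¹ l) ≡ true
    reverse-preserved⇒preserved {k} {l} h = preserved⁺ s record
      { in-U-src = proj₁ (φ∘φ⁻¹ k in-U-src)
      ; in-U-tgt = proj₁ (φ∘φ⁻¹ l in-U-tgt)
      ; edge-dom = edge-cod
      ; edge-cod = subst₂ (λ a b → edge G' a b ≡ true)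
                   (sym (proj₂ (φ∘φ⁻¹ k in-U-src))) (sym (proj₂ (φ∘φ⁻¹ l in-U-tgt))) edge-dom
      }
      where open Preserved (preserved⁻ reverse h)

    score≤score-reverse : score s ≤ score reverse
    score≤score-reverse = countPairs-injection φ U (preserved s) (preserved reverse)
      (λ i j h → let open Preserved (preserved⁻ s h) in
                 (in-U-src , in-U-tgt) , preserved⇒reverse-preserved h)
      inj

  module _ {L : Set} {G G' G'' : Digraph L} where

    _⨾_ : Feasible G G' → Feasible G' G'' → Feasible G G''
    s₁ ⨾ s₂ = record
      { U   = λ i → U₁ i ∧ U₂ (φ₁ i)
      ; φ   = λ i → φ₂ (φ₁ i)
      ; inj = λ i j Ui Uj eq →
                let U₁i , U₂i = ∧-true⁻ Ui
                    U₁j , U₂j = ∧-true⁻ Uj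
                in injective₁ i j U₁i U₁j (injective₂ (φ₁ i) (φ₁ j) U₂i U₂j eq)
      ; lab = λ i Ui → let U₁i , U₂i = ∧-true⁻ Ui in trans (lab₂ (φ₁ i) U₂i) (lab₁ i U₁i)
      }
      where
      open Feasible s₁ renaming (U to U₁; φ to φ₁; inj to injective₁; lab to lab₁)
      open Feasible s₂ renaming (U to U₂; φ to φ₂; inj to injective₂; lab to lab₂)

    ⨾-preserved : (s₁ : Feasible G G') (s₂ : Feasible G' G'') {i j : Fin (n G)} →
                  let φ₁ = Feasible.φ s₁ in
                  preserved s₁ i j ≡ true → preserved s₂ (φ₁ i) (φ₁ j) ≡ true → preserved (s₁ ⨾ s₂) i j ≡ true
    ⨾-preserved s₁ s₂ h₁ h₂ = preserved⁺ (s₁ ⨾ s₂) record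
      { in-U-src = ∧-true⁺ P₁.in-U-src P₂.in-U-src
      ; in-U-tgt = ∧-true⁺ P₁.in-U-tgt P₂.in-U-tgt
      ; edge-dom = P₁.edge-dom
      ; edge-cod = P₂.edge-cod
      }
      where
      module P₁ = Preserved (preserved⁻ s₁ h₁)
      module P₂ = Preserved (preserved⁻ s₂ h₂)

    score-⨾ : (s₁ : Feasible G G') (s₂ : Feasible G' G'') → Fin (n G) →
              score s₁ + score s₂ ≤ score (s₁ ⨾ s₂) + edgeCount G'
    score-⨾ s₁ s₂ default = begin
      score s₁ + score s₂
        ≤⟨ +-monoˡ-≤ (score s₂) (score≤score-reverse s₁ default) ⟩
      countPairs (n G') p + countPairs (n G') q
        ≡⟨ countPairs-∧+∨ p q ⟨
      countPairs (n G') (λ k l → p k l ∧ q k l) + countPairs (n G') (λ k l → p k l ∨ q k l)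
        ≤⟨ +-mono-≤ common≤score both≤edgeCount ⟩
      score (s₁ ⨾ s₂) + edgeCount G'
        ∎
      where
      open ≤-Reasoning
      t = reverse s₁ default
      p = preserved t
      q = preserved s₂
      ψ = φ⁻¹ s₁ default

      common⇒preserved : ∀ k l → p k l ∧ q k l ≡ true → preserved (s₁ ⨾ s₂) (ψ k) (ψ l) ≡ true
      common⇒preserved k l h = ⨾-preserved s₁ s₂ (reverse-preserved⇒preserved s₁ default pkl) q-ψ
        where
        pkl = proj₁ (∧-true⁻ {p k l} h)
        open Preserved (preserved⁻ t pkl)
        q-ψ : q (Feasible.φ s₁ (ψ k)) (Feasible.φ s₁ (ψ l)) ≡ true
        q-ψ = subst₂ (λ a b → q a b ≡ true)
                (sym (proj₂ (φ∘φ⁻¹ s₁ default k in-U-src))) (sym (proj₂ (φ∘φ⁻¹ s₁ default l in-U-tgt)))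
                (proj₂ (∧-true⁻ {p k l} h))

      common≤score : countPairs (n G') (λ k l → p k l ∧ q k l) ≤ score (s₁ ⨾ s₂)
      common≤score = countPairs-injection ψ (U⁻¹ s₁ default) (λ k l → p k l ∧ q k l) (preserved (s₁ ⨾ s₂))
        (λ k l h → let open Preserved (preserved⁻ t (proj₁ (∧-true⁻ {p k l} h))) in
                   (in-U-src , in-U-tgt) , common⇒preserved k l h)
        (φ⁻¹-injective s₁ default)

      both≤edgeCount : countPairs (n G') (λ k l → p k l ∨ q k l) ≤ edgeCount G'
      both≤edgeCount = countPairs-mono (λ k l → p k l ∨ q k l) (edge G') edge-of
        where
        edge-of : ∀ k l → p k l ∨ q k l ≡ true → edge G' k l ≡ true
        edge-of k l h with p k l in pkl
        ... | true  = preserved⊆edge t k l pkl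
        ... | false = preserved⊆edge s₂ k l h

  NoIsolatedNode : {L : Set} → Digraph L → Set
  NoIsolatedNode G = ∀ i → Σ (Fin (n G)) (λ j → edge G i j ≡ true ⊎ edge G j i ≡ true)

  module _ {L : Set} {G : Digraph L} where

    weaklyConnected⇒noIsolatedNode : WeaklyConnected G → ∀ {a b} → edge G a b ≡ true → NoIsolatedNode G
    weaklyConnected⇒noIsolatedNode connected {a} {b} eab i with connected i a
    ... | here          = b , inj₁ eab
    ... | fwd {j = j} e _ = j , inj₁ e
    ... | bwd {j = j} e _ = j , inj₂ e

    edgeCount≤score⇒total : {G' : Digraph L} (s : Feasible G G') → NoIsolatedNode G →
                            edgeCount G ≤ score s → ∀ i → Feasible.U s i ≡ true
    edgeCount≤score⇒total s noIsolated full i with noIsolated i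
    ... | j , inj₁ eij = Preserved.in-U-src (preserved⁻ s (edgeCount≤score⇒preserved s full i j eij))
    ... | j , inj₂ eji = Preserved.in-U-tgt (preserved⁻ s (edgeCount≤score⇒preserved s full j i eji))

  edgeCount≤score⇒Iso : {L : Set} {G G' : Digraph L} → NoIsolatedNode G → NoIsolatedNode G' →
    (s : Feasible G G') → Fin (n G) → edgeCount G ≤ score s → edgeCount G' ≤ score s → Iso G G'
  edgeCount≤score⇒Iso {G = G} {G'} noIsolated noIsolated′ s default full full′ = record
    { γ         = mk↔ₛ′ φ ψ (λ k → proj₂ (φ∘φ⁻¹ s default k (U⁻¹-total k)))
                            (λ i → proj₂ (φ⁻¹∘φ s default i (U-total i)))
    ; labelPres = λ i → lab i (U-total i)
    ; edgePres  = λ i j → Bool.⇔→≡ (mk⇔ (reflects i j) (preserves i j))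
    }
    where
    open Feasible s
    t = reverse s default
    ψ = φ⁻¹ s default
    U-total : ∀ i → U i ≡ true
    U-total = edgeCount≤score⇒total s noIsolated full
    full-t : edgeCount G' ≤ score t
    full-t = ≤-trans full′ (score≤score-reverse s default)
    U⁻¹-total : ∀ k → U⁻¹ s default k ≡ true
    U⁻¹-total = edgeCount≤score⇒total t noIsolated′ full-t
    preserves : ∀ i j → edge G i j ≡ true → edge G' (φ i) (φ j) ≡ true
    preserves i j = Preserved.edge-cod ∘ preserved⁻ s ∘ edgeCount≤score⇒preserved s full i j
    reflects : ∀ i j → edge G' (φ i) (φ j) ≡ true → edge G i j ≡ true
    reflects i j e = subst₂ (λ a b → edge G a b ≡ true)
      (proj₂ (φ⁻¹∘φ s default i (U-total i))) (proj₂ (φ⁻¹∘φ s default j (U-total j)))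
      (Preserved.edge-cod (preserved⁻ t (edgeCount≤score⇒preserved t full-t (φ i) (φ j) e)))

  Iso-sym : {L : Set} {G G' : Digraph L} → Iso G G' → Iso G' G
  Iso-sym {G = G} {G'} iso = record
    { γ         = ↔-sym γ
    ; labelPres = λ k → trans (sym (labelPres (from k))) (cong (label G') (strictlyInverseˡ k))
    ; edgePres  = λ k l → trans (sym (edgePres (from k) (from l)))
                                (cong₂ (edge G') (strictlyInverseˡ k) (strictlyInverseˡ l))
    }
    where
    open Iso iso
    open Inverse γ using (from; strictlyInverseˡ)

  Iso⇒solution : {L : Set} {G G' : Digraph L} → Iso G G' → Feasible G G'
  Iso⇒solution iso = record
    { U   = λ _ → true
    ; φ   = to
    ; inj = λ i j _ _ → Injection.injective (↔⇒↣ γ)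
    ; lab = λ i _ → labelPres i
    }
    where
    open Iso iso
    open Inverse γ using (to)

  edgeCount≤score-Iso⇒solution : {L : Set} {G G' : Digraph L} (iso : Iso G G') →
                                 edgeCount G ≤ score (Iso⇒solution iso)
  edgeCount≤score-Iso⇒solution {G = G} iso = countPairs-mono (edge G) (preserved (Iso⇒solution iso))
    λ i j e → preserved⁺ (Iso⇒solution iso) record
      { in-U-src = refl ; in-U-tgt = refl ; edge-dom = e ; edge-cod = trans (Iso.edgePres iso i j) e }

  module _ {L : Set} {G G' : Digraph L} where

    DMCES≤edgeCount-dom : ∀ {k} → IsDMCES G G' k → k ≤ edgeCount G
    DMCES≤edgeCount-dom ((s , refl) , _) = score≤edgeCount-dom s

    DMCES≤edgeCount-cod : ∀ {k} → IsDMCES G G' k → k ≤ edgeCount G'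
    DMCES≤edgeCount-cod ((s , refl) , _) = score≤edgeCount-cod s

    DMCES-sym-≤ : ∀ {k k′} → Fin (n G) → IsDMCES G G' k → IsDMCES G' G k′ → k ≤ k′
    DMCES-sym-≤ default ((s , refl) , _) (_ , optimal) =
      ≤-trans (score≤score-reverse s default) (optimal (reverse s default))

    Iso⇒edgeCount≤DMCES : ∀ {k} → Iso G G' → IsDMCES G G' k → edgeCount G ≤ k
    Iso⇒edgeCount≤DMCES iso (_ , optimal) =
      ≤-trans (edgeCount≤score-Iso⇒solution iso) (optimal (Iso⇒solution iso))

    edgeCount≤DMCES⇒Iso : ∀ {k} → NoIsolatedNode G → NoIsolatedNode G' → Fin (n G) → IsDMCES G G' k →
                          edgeCount G ≤ k → edgeCount G' ≤ k → Iso G G'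
    edgeCount≤DMCES⇒Iso noIsolated noIsolated′ default ((s , refl) , _) =
      edgeCount≤score⇒Iso noIsolated noIsolated′ s default

  DMCES-triangle : {L : Set} {G G' G'' : Digraph L} {x y z : ℕ} → Fin (n G) →
    IsDMCES G G' x → IsDMCES G' G'' y → IsDMCES G G'' z → x + y ≤ z + edgeCount G'
  DMCES-triangle {G' = G'} default ((s₁ , refl) , _) ((s₂ , refl) , _) (_ , optimal) =
    ≤-trans (score-⨾ s₁ s₂ default) (+-monoˡ-≤ (edgeCount G') (optimal (s₁ ⨾ s₂)))

module TriangleArithmetic where

  open import Data.Nat using (ℕ; _+_; _*_; _≤_; _⊔_)
  open import Data.Nat.Properties
    using (≤-trans; ≤-reflexive; ≤-total; m≤m⊔n; m≤n⊔m; ⊔-lub; m≤n⇒m⊔n≡n; m≥n⇒m⊔n≡m; m≤n⇒∃[o]m+o≡n;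
           +-comm; *-comm; +-mono-≤; +-monoˡ-≤; +-monoʳ-≤; *-monoˡ-≤; *-monoʳ-≤; module ≤-Reasoning)
  open import Data.Nat.Solver using (module +-*-Solver)
  open +-*-Solver using (solve; _:+_; _:*_; _:=_)
  open import Data.Product using (_,_)
  open import Data.Sum using (inj₁; inj₂)
  open import Relation.Binary.PropositionalEquality using (refl; cong; subst₂)

  -- x / A + y / B ≤ 1 + z / C with the denominators cleared.
  Triangle : (A B C x y z : ℕ) → Set
  Triangle A B C x y z = (x * B + y * A) * C ≤ (C + z) * (A * B)

  Triangle-swap : ∀ {A B C x y z} → Triangle A B C x y z → Triangle B A C y x z
  Triangle-swap {A} {B} {C} {x} {y} {z} =
    subst₂ _≤_ (cong (_* C) (+-comm (x * B) (y * A))) (cong ((C + z) *_) (*-comm A B))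

  Triangle-middle : ∀ {M C x y z} → x + y ≤ z + M → C ≤ M → Triangle M M C x y z
  Triangle-middle {M} {C} {x} {y} {z} x+y≤z+M C≤M = begin
    (x * M + y * M) * C
      ≡⟨ solve 4 (λ M C x y → (x :* M :+ y :* M) :* C := (x :+ y) :* (M :* C)) refl M C x y ⟩
    (x + y) * (M * C)
      ≤⟨ *-monoˡ-≤ (M * C) x+y≤z+M ⟩
    (z + M) * (M * C)
      ≡⟨ solve 3 (λ M C z → (z :+ M) :* (M :* C) := z :* (M :* C) :+ C :* (M :* M)) refl M C z ⟩
    z * (M * C) + C * (M * M)
      ≤⟨ +-monoˡ-≤ (C * (M * M)) (*-monoʳ-≤ z (*-monoʳ-≤ M C≤M)) ⟩
    z * (M * M) + C * (M * M)
      ≡⟨ solve 3 (λ M C z → z :* (M :* M) :+ C :* (M :* M) := (C :+ z) :* (M :* M)) refl M C z ⟩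
    (C + z) * (M * M)
      ∎
    where open ≤-Reasoning

  Triangle-outer : ∀ {M B x y z} → y ≤ B → x + y ≤ z + B → B ≤ M → Triangle M B M x y z
  Triangle-outer {M} {B} {x} {y} {z} y≤B x+y≤z+B B≤M with m≤n⇒∃[o]m+o≡n B≤M
  ... | p , refl = begin
    (x * B + y * (B + p)) * (B + p)
      ≡⟨ solve 4 (λ B p x y → (x :* B :+ y :* (B :+ p)) :* (B :+ p) := ((x :+ y) :* B :+ y :* p) :* (B :+ p))
                 refl B p x y ⟩
    ((x + y) * B + y * p) * (B + p)
      ≤⟨ *-monoˡ-≤ (B + p) (+-mono-≤ (*-monoˡ-≤ B x+y≤z+B) (*-monoˡ-≤ p y≤B)) ⟩
    ((z + B) * B + B * p) * (B + p)
      ≡⟨ solve 3 (λ B p z → ((z :+ B) :* B :+ B :* p) :* (B :+ p) := ((B :+ p) :+ z) :* ((B :+ p) :* B))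
                 refl B p z ⟩
    ((B + p) + z) * ((B + p) * B)
      ∎
    where open ≤-Reasoning

  Triangle-⊔ : ∀ {e₁ e₂ e₃ x y z} → x ≤ e₂ → y ≤ e₂ → x + y ≤ z + e₂ →
               Triangle (e₁ ⊔ e₂) (e₂ ⊔ e₃) (e₁ ⊔ e₃) x y z
  Triangle-⊔ {e₁} {e₂} {e₃} {x} {y} {z} x≤e₂ y≤e₂ x+y≤z+e₂ with ≤-total (e₁ ⊔ e₃) e₂
  ... | inj₁ e₁⊔e₃≤e₂
    rewrite m≤n⇒m⊔n≡n (≤-trans (m≤m⊔n e₁ e₃) e₁⊔e₃≤e₂) | m≥n⇒m⊔n≡m (≤-trans (m≤n⊔m e₁ e₃) e₁⊔e₃≤e₂)
    = Triangle-middle {x = x} {y} x+y≤z+e₂ e₁⊔e₃≤e₂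
  ... | inj₂ e₂≤e₁⊔e₃ with ≤-total e₃ e₁
  ...   | inj₁ e₃≤e₁ rewrite m≥n⇒m⊔n≡m e₃≤e₁ | m≥n⇒m⊔n≡m e₂≤e₁⊔e₃
    = Triangle-outer (≤-trans y≤e₂ (m≤m⊔n e₂ e₃)) (≤-trans x+y≤z+e₂ (+-monoʳ-≤ z (m≤m⊔n e₂ e₃)))
                     (⊔-lub e₂≤e₁⊔e₃ e₃≤e₁)
  ...   | inj₂ e₁≤e₃ rewrite m≤n⇒m⊔n≡n e₁≤e₃ | m≤n⇒m⊔n≡n e₂≤e₁⊔e₃
    = Triangle-swap {e₃} {e₁ ⊔ e₂} {e₃} {y} {x} {z}
        (Triangle-outer (≤-trans x≤e₂ (m≤n⊔m e₁ e₂)) y+x≤z+e₁⊔e₂ (⊔-lub e₁≤e₃ e₂≤e₁⊔e₃))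
    where
    y+x≤z+e₁⊔e₂ : y + x ≤ z + (e₁ ⊔ e₂)
    y+x≤z+e₁⊔e₂ = ≤-trans (≤-reflexive (+-comm y x)) (≤-trans x+y≤z+e₂ (+-monoʳ-≤ z (m≤n⊔m e₁ e₂)))

module Fractions where

  open import Data.Nat as ℕ using (ℕ; suc; NonZero; z≤n)
  import Data.Nat.Properties as ℕ
  open import Data.Integer as ℤ using (+_)
  import Data.Integer.Properties as ℤ
  open import Data.Rational using (0ℚ; 1ℚ; _/_; _+_; _-_; _≤_; toℚᵘ)
  open import Data.Rational.Properties
    using (toℚᵘ-fromℚᵘ; toℚᵘ-cancel-≤; toℚᵘ-injective; toℚᵘ-homo-+; toℚᵘ-cong; ≤-reflexive; ≤-trans;
           +-monoʳ-≤; neg-antimono-≤; +-inverseʳ; +-0-group; module ≤-Reasoning)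
  open import Data.Rational.Unnormalised as ℚᵘ using (mkℚᵘ; *≤*; *≡*) renaming (_/_ to _/ᵘ_)
  import Data.Rational.Unnormalised.Properties as ℚᵘ
  import Data.Rational.Solver as ℚ-Solver
  open import Algebra.Properties.Group +-0-group using (x∙y⁻¹≈ε⇒x≈y; x≈y⇒x∙y⁻¹≈ε)
  open import Function.Bundles using (_⇔_; mk⇔)
  open import Relation.Binary.PropositionalEquality using (_≡_; refl; sym; trans; cong; cong₂; subst₂)
  open TriangleArithmetic using (Triangle)

  toℚᵘ-/ : ∀ a b .{{_ : NonZero b}} → toℚᵘ (+ a / b) ℚᵘ.≃ (+ a /ᵘ b)
  toℚᵘ-/ a (suc b-1) = toℚᵘ-fromℚᵘ (mkℚᵘ (+ a) b-1)

  a*d≤c*b⇒a/b≤c/d : ∀ a b c d .{{_ : NonZero b}} .{{_ : NonZero d}} → a ℕ.* d ℕ.≤ c ℕ.* b → + a / b ≤ + c / d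
  a*d≤c*b⇒a/b≤c/d a b c d ad≤cb = toℚᵘ-cancel-≤
    (ℚᵘ.≤-respˡ-≃ (ℚᵘ.≃-sym (toℚᵘ-/ a b)) (ℚᵘ.≤-respʳ-≃ (ℚᵘ.≃-sym (toℚᵘ-/ c d)) (unnormalised b d ad≤cb)))
    where
    unnormalised : ∀ b d .{{_ : NonZero b}} .{{_ : NonZero d}} → a ℕ.* d ℕ.≤ c ℕ.* b → (+ a /ᵘ b) ℚᵘ.≤ (+ c /ᵘ d)
    unnormalised (suc _) (suc _) ad≤cb = *≤* (subst₂ ℤ._≤_ (ℤ.pos-* a _) (ℤ.pos-* c _) (ℤ.+≤+ ad≤cb))

  a/b+c/d≡[a*d+c*b]/[b*d] : ∀ a b c d .{{_ : NonZero b}} .{{_ : NonZero d}} →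
    + a / b + + c / d ≡ (+ (a ℕ.* d ℕ.+ c ℕ.* b) / (b ℕ.* d)) {{ℕ.m*n≢0 b d}}
  a/b+c/d≡[a*d+c*b]/[b*d] a b c d = toℚᵘ-injective (begin
    toℚᵘ (+ a / b + + c / d)                ≈⟨ toℚᵘ-homo-+ (+ a / b) (+ c / d) ⟩
    toℚᵘ (+ a / b) ℚᵘ.+ toℚᵘ (+ c / d)      ≈⟨ ℚᵘ.+-cong (toℚᵘ-/ a b) (toℚᵘ-/ c d) ⟩
    (+ a /ᵘ b) ℚᵘ.+ (+ c /ᵘ d)              ≈⟨ unnormalised b d ⟩
    (+ (a ℕ.* d ℕ.+ c ℕ.* b) /ᵘ (b ℕ.* d)) {{ℕ.m*n≢0 b d}}
                                            ≈⟨ toℚᵘ-/ (a ℕ.* d ℕ.+ c ℕ.* b) (b ℕ.* d) {{ℕ.m*n≢0 b d}} ⟨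
    toℚᵘ ((+ (a ℕ.* d ℕ.+ c ℕ.* b) / (b ℕ.* d)) {{ℕ.m*n≢0 b d}}) ∎)
    where
    open ℚᵘ.≃-Reasoning
    unnormalised : ∀ b d .{{_ : NonZero b}} .{{_ : NonZero d}} →
      (+ a /ᵘ b) ℚᵘ.+ (+ c /ᵘ d) ℚᵘ.≃ (+ (a ℕ.* d ℕ.+ c ℕ.* b) /ᵘ (b ℕ.* d)) {{ℕ.m*n≢0 b d}}
    unnormalised (suc b-1) (suc d-1) = ℚᵘ.≃-reflexive (cong (λ n → mkℚᵘ n (d-1 ℕ.+ b-1 ℕ.* suc d-1))
      (cong₂ ℤ._+_ (sym (ℤ.pos-* a (suc d-1))) (sym (ℤ.pos-* c (suc b-1)))))

  m/m≡1 : ∀ m .{{_ : NonZero m}} → + m / m ≡ 1ℚ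
  m/m≡1 m@(suc _) = toℚᵘ-injective (ℚᵘ.≃-trans (toℚᵘ-/ m m) (*≡* (ℤ.*-comm (+ m) (+ 1))))

  n/m≡1⇒n≡m : ∀ n m .{{_ : NonZero m}} → + n / m ≡ 1ℚ → n ≡ m
  n/m≡1⇒n≡m n m@(suc _) n/m≡1 with ℚᵘ.≃-trans (ℚᵘ.≃-sym (toℚᵘ-/ n m)) (toℚᵘ-cong n/m≡1)
  ... | *≡* n*1≡1*m = ℤ.+-injective (trans (sym (ℤ.*-identityʳ (+ n))) (trans n*1≡1*m (ℤ.*-identityˡ (+ m))))

  0≤n/m : ∀ n m .{{_ : NonZero m}} → 0ℚ ≤ + n / m
  0≤n/m n m = a*d≤c*b⇒a/b≤c/d 0 1 n m z≤n

  n≤m⇒n/m≤1 : ∀ {n m} .{{_ : NonZero m}} → n ℕ.≤ m → + n / m ≤ 1ℚ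
  n≤m⇒n/m≤1 {n} {m} n≤m =
    a*d≤c*b⇒a/b≤c/d n m 1 1 (subst₂ ℕ._≤_ (sym (ℕ.*-identityʳ n)) (sym (ℕ.*-identityˡ m)) n≤m)

  n≤m⇒0≤1-n/m : ∀ {n m} .{{_ : NonZero m}} → n ℕ.≤ m → 0ℚ ≤ 1ℚ - + n / m
  n≤m⇒0≤1-n/m n≤m =
    ≤-trans (≤-reflexive (sym (+-inverseʳ 1ℚ))) (+-monoʳ-≤ 1ℚ (neg-antimono-≤ (n≤m⇒n/m≤1 n≤m)))

  1-n/m≤1 : ∀ n m .{{_ : NonZero m}} → 1ℚ - + n / m ≤ 1ℚ
  1-n/m≤1 n m = +-monoʳ-≤ 1ℚ (neg-antimono-≤ (0≤n/m n m))

  1-n/m≡0⇔n≡m : ∀ n m .{{_ : NonZero m}} → (1ℚ - + n / m ≡ 0ℚ) ⇔ (n ≡ m)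
  1-n/m≡0⇔n≡m n m = mk⇔
    (λ 1-n/m≡0 → n/m≡1⇒n≡m n m (sym (x∙y⁻¹≈ε⇒x≈y 1ℚ (+ n / m) 1-n/m≡0)))
    (λ { refl → x≈y⇒x∙y⁻¹≈ε (sym (m/m≡1 m)) })

  Triangle⇒1-z/C≤[1-x/A]+[1-y/B] : ∀ {A B C x y z} .{{_ : NonZero A}} .{{_ : NonZero B}} .{{_ : NonZero C}} →
    Triangle A B C x y z → 1ℚ - + z / C ≤ (1ℚ - + x / A) + (1ℚ - + y / B)
  Triangle⇒1-z/C≤[1-x/A]+[1-y/B] {A} {B} {C} {x} {y} {z} cleared = begin
    1ℚ - z/C                   ≡⟨ ℚ-solve 2 (λ o q → o :- q := (o :+ o) :- (o :+ q)) refl 1ℚ z/C ⟩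
    (1ℚ + 1ℚ) - (1ℚ + z/C)     ≤⟨ +-monoʳ-≤ (1ℚ + 1ℚ) (neg-antimono-≤ sum≤1+z/C) ⟩
    (1ℚ + 1ℚ) - (x/A + y/B)    ≡⟨ ℚ-solve 3 (λ o p q → (o :+ o) :- (p :+ q) := (o :- p) :+ (o :- q)) refl 1ℚ x/A y/B ⟩
    (1ℚ - x/A) + (1ℚ - y/B)    ∎
    where
    open ≤-Reasoning
    open ℚ-Solver.+-*-Solver using (_:+_; _:-_; _:=_) renaming (solve to ℚ-solve)
    x/A = + x / A
    y/B = + y / B
    z/C = + z / C
    cleared′ : (x ℕ.* B ℕ.+ y ℕ.* A) ℕ.* (1 ℕ.* C) ℕ.≤ (1 ℕ.* C ℕ.+ z ℕ.* 1) ℕ.* (A ℕ.* B)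
    cleared′ = subst₂ ℕ._≤_
      (cong ((x ℕ.* B ℕ.+ y ℕ.* A) ℕ.*_) (sym (ℕ.*-identityˡ C)))
      (cong (ℕ._* (A ℕ.* B)) (cong₂ ℕ._+_ (sym (ℕ.*-identityˡ C)) (sym (ℕ.*-identityʳ z))))
      cleared
    sum≤1+z/C : x/A + y/B ≤ 1ℚ + z/C
    sum≤1+z/C = subst₂ _≤_ (sym (a/b+c/d≡[a*d+c*b]/[b*d] x A y B)) (sym (a/b+c/d≡[a*d+c*b]/[b*d] 1 1 z C))
      (a*d≤c*b⇒a/b≤c/d (x ℕ.* B ℕ.+ y ℕ.* A) (A ℕ.* B) (1 ℕ.* C ℕ.+ z ℕ.* 1) (1 ℕ.* C)
                       {{ℕ.m*n≢0 A B}} {{ℕ.m*n≢0 1 C}} cleared′)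

module DMCESDistance {L : Set} (dm : WSO L → WSO L → ℕ)
                     (isDMCES : ∀ G G' → IsDMCES (graph G) (graph G') (dm G G')) where

  open import Data.Nat as ℕ using (ℕ; _⊔_; NonZero; >-nonZero)
  open import Data.Nat.Properties using (≤-trans; ≤-antisym; ≤-reflexive; m≤m⊔n; m≤n⊔m; ⊔-lub; ⊔-comm)
  open import Data.Integer using (+_)
  open import Data.Rational using (0ℚ; 1ℚ; _≤_; _+_; _-_)
  open import Data.Rational.Properties using (/-cong)
  open import Data.Bool using (true)
  open import Data.Fin using (Fin)
  open import Data.Product using (Σ; _×_; _,_; proj₁; proj₂)
  open import Function.Bundles using (_⇔_; mk⇔)
  import Function.Properties.Equivalence as ⇔
  open import Relation.Binary.PropositionalEquality using (_≡_; sym; cong)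
  open Counting using (countPairs-witness)
  open Solutions
  open TriangleArithmetic using (Triangle-⊔)
  open Fractions

  e : WSO L → ℕ
  e G = edgeCount (graph G)

  ⊔-nonZero : ∀ G G' → NonZero (e G ⊔ e G')
  ⊔-nonZero G G' = >-nonZero (≤-trans (hasEdge G) (m≤m⊔n (e G) (e G')))

  some-edge : (G : WSO L) →
              Σ (Fin (n (graph G)) × Fin (n (graph G))) (λ (i , j) → edge (graph G) i j ≡ true)
  some-edge G = countPairs-witness (edge (graph G)) (hasEdge G)

  node : (G : WSO L) → Fin (n (graph G))
  node G = proj₁ (proj₁ (some-edge G))

  noIsolatedNode : (G : WSO L) → NoIsolatedNode (graph G)
  noIsolatedNode G = weaklyConnected⇒noIsolatedNode (weakly G) (proj₂ (some-edge G))

  dm≤⊔ : ∀ G G' → dm G G' ℕ.≤ e G ⊔ e G'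
  dm≤⊔ G G' = ≤-trans (DMCES≤edgeCount-dom (isDMCES G G')) (m≤m⊔n (e G) (e G'))

  dm-sym : ∀ G G' → dm G G' ≡ dm G' G
  dm-sym G G' = ≤-antisym (DMCES-sym-≤ (node G) (isDMCES G G') (isDMCES G' G))
                          (DMCES-sym-≤ (node G') (isDMCES G' G) (isDMCES G G'))

  dm≡⊔⇔Iso : ∀ G G' → (dm G G' ≡ e G ⊔ e G') ⇔ Iso (graph G) (graph G')
  dm≡⊔⇔Iso G G' = mk⇔ maximal⇒Iso Iso⇒maximal
    where
    maximal⇒Iso : dm G G' ≡ e G ⊔ e G' → Iso (graph G) (graph G')
    maximal⇒Iso dm≡⊔ = edgeCount≤DMCES⇒Iso (noIsolatedNode G) (noIsolatedNode G') (node G) (isDMCES G G')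
      (≤-trans (m≤m⊔n (e G) (e G')) (≤-reflexive (sym dm≡⊔)))
      (≤-trans (m≤n⊔m (e G) (e G')) (≤-reflexive (sym dm≡⊔)))
    Iso⇒maximal : Iso (graph G) (graph G') → dm G G' ≡ e G ⊔ e G'
    Iso⇒maximal iso = ≤-antisym (dm≤⊔ G G') (⊔-lub
      (Iso⇒edgeCount≤DMCES iso (isDMCES G G'))
      (≤-trans (Iso⇒edgeCount≤DMCES (Iso-sym iso) (isDMCES G' G)) (≤-reflexive (dm-sym G' G))))

  dₑ-bounds : ∀ G G' → (0ℚ ≤ dₑ dm G G') × (dₑ dm G G' ≤ 1ℚ)
  dₑ-bounds G G' = n≤m⇒0≤1-n/m {{⊔-nonZero G G'}} (dm≤⊔ G G')
                 , 1-n/m≤1 (dm G G') (e G ⊔ e G') {{⊔-nonZero G G'}}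

  dₑ≡0⇔Iso : ∀ G G' → (dₑ dm G G' ≡ 0ℚ) ⇔ Iso (graph G) (graph G')
  dₑ≡0⇔Iso G G' = ⇔.trans (1-n/m≡0⇔n≡m (dm G G') (e G ⊔ e G') {{⊔-nonZero G G'}}) (dm≡⊔⇔Iso G G')

  dₑ-sym : ∀ G G' → dₑ dm G G' ≡ dₑ dm G' G
  dₑ-sym G G' = cong (1ℚ -_)
    (/-cong {{⊔-nonZero G G'}} {{⊔-nonZero G' G}} (cong +_ (dm-sym G G')) (⊔-comm (e G) (e G')))

  dₑ-triangle : ∀ G G' G'' → dₑ dm G G'' ≤ dₑ dm G G' + dₑ dm G' G''
  dₑ-triangle G G' G'' =
    Triangle⇒1-z/C≤[1-x/A]+[1-y/B] {x = dm G G'} {dm G' G''} {dm G G''}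
      {{⊔-nonZero G G'}} {{⊔-nonZero G' G''}} {{⊔-nonZero G G''}}
      (Triangle-⊔ {e G} {e G'} {e G''}
        (DMCES≤edgeCount-cod (isDMCES G G'))
        (DMCES≤edgeCount-dom (isDMCES G' G''))
        (DMCES-triangle (node G) (isDMCES G G') (isDMCES G' G'') (isDMCES G G'')))

open import Data.Rational using (0ℚ; 1ℚ; _≤_; _+_)
open import Data.Product using (_×_; _,_)
open import Relation.Binary.PropositionalEquality using (_≡_)
open import Function.Bundles using (_⇔_)

theorem5p5 : (L : Set) (dm : WSO L → WSO L → ℕ)
    → (∀ G G' → IsDMCES (graph G) (graph G') (dm G G'))
    → (∀ G G' → (0ℚ ≤ dₑ dm G G') × (dₑ dm G G' ≤ 1ℚ))
    × (∀ G G' → (dₑ dm G G' ≡ 0ℚ) ⇔ Iso (graph G) (graph G'))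
    × (∀ G G' → dₑ dm G G' ≡ dₑ dm G' G)
    × (∀ G G' G'' → dₑ dm G G'' ≤ dₑ dm G G' + dₑ dm G' G'')
theorem5p5 L dm isDMCES = dₑ-bounds , dₑ≡0⇔Iso , dₑ-sym , dₑ-triangle
  where open DMCESDistance dm isDMCES
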